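{- (i) In a category with biproducts $(0,\oplus)$ (used as coproducts), all squares of type (E) and (K) are pullbacks. For $f\colon X\to Y$ and $g\colon A\to B$ with $g$ zero monic (i.e. $g\circ h=0$ implies $h=0$), the square of type (K+) with top $f$, bottom $f\oplus g\colon X\oplus A\to Y\oplus B$ and verticals $\kappa_1$ is a pullback. (ii) In an additive category, for every $X$ the two maps $[\mathrm{id},\kappa_2]=\langle\pi_1\circ\pi_1,(\pi_2\circ\pi_1)+\pi_2\rangle$ and $[[\kappa_2,\kappa_1],\kappa_2]=\langle\pi_2\circ\pi_1,(\pi_1\circ\pi_1)+\pi_2\rangle$ from $(X\oplus X)\oplus X$ to $X\oplus X$ are jointly monic. (iii) In a dagger biproduct category, for a unitary map $f\colon X\to Y$ (i.e. $f^\dagger f=\mathrm{id}$ and $ff^\dagger=\mathrm{id}$), the squares of type (D) and (D+) for $f$ are pullbacks.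
   Context: Biproducts: $0$ is a zero object, and $X_1\oplus X_2$ has coprojections $\kappa_i$ and projections $\pi_j$ with $\pi_j\kappa_i=\mathrm{id}$ if $i=j$ and $0$ otherwise. $\langle-,-\rangle$ denotes tuples, $[-,-]$ cotuples, $h\oplus k$ the biproduct of maps, and $\nabla=[\mathrm{id},\mathrm{id}]$. Homsets carry addition $f+g=\nabla\circ(f\oplus g)\circ\langle\mathrm{id},\mathrm{id}\rangle$. An additive category is a biproduct category whose homsets are abelian groups under $+$. A dagger biproduct category additionally has an identity-on-objects involutive functor $(-)^\dagger$ from $\mathcal{C}^{op}$ to $\mathcal{C}$ with $\pi_i^\dagger=\kappa_i$. (E): for $f\colon A\to B$ and $g\colon X\to Y$, the square with top $\mathrm{id}\oplus g\colon A\oplus X\to A\oplus Y$, bottom $\mathrm{id}\oplus g\colon B\oplus X\to B\oplus Y$ and verticals $f\oplus\mathrm{id}$. (K): for $f\colon X\to Y$ and any $A$, the square with top $f$, bottom $f\oplus\mathrm{id}\colon X\oplus A\to Y\oplus A$ and verticals $\kappa_1$. (D): the square with top $f\oplus f$, bottom $f$ and verticals $\nabla$. (D+): the square with top $(f\oplus f)\oplus f$, bottom $f\oplus f$ and verticals $\nabla\oplus\mathrm{id}$. -}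

module Defs where

open import Level using (Level; _⊔_; suc)
open import Data.Product using (Σ; _×_; _,_)
open import Relation.Binary.Structures using (IsEquivalence)
open import Algebra.Structures using (IsAbelianGroup)

record Category (o ℓ e : Level) : Set (suc (o ⊔ ℓ ⊔ e)) where
  infixr 9 _∘_
  infix  3 _⇒_
  infix  4 _≈_
  field
    Obj : Set o
    _⇒_ : Obj → Obj → Set ℓ
    _≈_ : ∀ {A B} → A ⇒ B → A ⇒ B → Set e
    ≈-equiv : ∀ {A B} → IsEquivalence (_≈_ {A} {B})
    id  : ∀ {A} → A ⇒ A
    _∘_ : ∀ {A B C} → B ⇒ C → A ⇒ B → A ⇒ C
    assoc : ∀ {A B C D} {f : A ⇒ B} {g : B ⇒ C} {h : C ⇒ D} →
            (h ∘ g) ∘ f ≈ h ∘ (g ∘ f)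
    identityˡ : ∀ {A B} {f : A ⇒ B} → id ∘ f ≈ f
    identityʳ : ∀ {A B} {f : A ⇒ B} → f ∘ id ≈ f
    ∘-resp-≈ : ∀ {A B C} {f h : B ⇒ C} {g i : A ⇒ B} →
               f ≈ h → g ≈ i → f ∘ g ≈ h ∘ i

  -- The square
  --      P --top--> Q
  --      |          |
  --    left       right
  --      v          v
  --      R --bot--> S
  -- commutes and is a pullback (of the cospan  R --bot--> S <--right-- Q).
  IsPullbackSquare : ∀ {P Q R S} → P ⇒ Q → P ⇒ R → Q ⇒ S → R ⇒ S → Set (o ⊔ ℓ ⊔ e)
  IsPullbackSquare {P} {Q} {R} top left right bot =
    (right ∘ top ≈ bot ∘ left) ×
    (∀ {Z} (h₁ : Z ⇒ Q) (h₂ : Z ⇒ R) → right ∘ h₁ ≈ bot ∘ h₂ →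
       Σ (Z ⇒ P) λ u → (top ∘ u ≈ h₁) × (left ∘ u ≈ h₂) ×
         (∀ (v : Z ⇒ P) → top ∘ v ≈ h₁ → left ∘ v ≈ h₂ → v ≈ u))

  JointlyMonic : ∀ {P Q} → P ⇒ Q → P ⇒ Q → Set (o ⊔ ℓ ⊔ e)
  JointlyMonic {P} m₁ m₂ =
    ∀ {Z} (u v : Z ⇒ P) → m₁ ∘ u ≈ m₁ ∘ v → m₂ ∘ u ≈ m₂ ∘ v → u ≈ v

record BiproductCategory (o ℓ e : Level) : Set (suc (o ⊔ ℓ ⊔ e)) where
  field
    category : Category o ℓ e
  open Category category public
  infixr 10 _⊕_
  field
    𝟘 : Obj
    ! : ∀ {A} → A ⇒ 𝟘
    !-unique : ∀ {A} (f : A ⇒ 𝟘) → f ≈ !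
    ¡ : ∀ {A} → 𝟘 ⇒ A
    ¡-unique : ∀ {A} (f : 𝟘 ⇒ A) → f ≈ ¡

  0m : ∀ {A B} → A ⇒ B
  0m = ¡ ∘ !

  field
    _⊕_ : Obj → Obj → Obj
    κ₁ : ∀ {A B} → A ⇒ A ⊕ B
    κ₂ : ∀ {A B} → B ⇒ A ⊕ B
    π₁ : ∀ {A B} → A ⊕ B ⇒ A
    π₂ : ∀ {A B} → A ⊕ B ⇒ B
    ⟨_,_⟩ : ∀ {Z A B} → Z ⇒ A → Z ⇒ B → Z ⇒ A ⊕ B
    π₁∘⟨⟩ : ∀ {Z A B} {f : Z ⇒ A} {g : Z ⇒ B} → π₁ ∘ ⟨ f , g ⟩ ≈ f
    π₂∘⟨⟩ : ∀ {Z A B} {f : Z ⇒ A} {g : Z ⇒ B} → π₂ ∘ ⟨ f , g ⟩ ≈ g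
    ⟨⟩-unique : ∀ {Z A B} {f : Z ⇒ A} {g : Z ⇒ B} (h : Z ⇒ A ⊕ B) →
                π₁ ∘ h ≈ f → π₂ ∘ h ≈ g → h ≈ ⟨ f , g ⟩
    [_,_] : ∀ {A B Z} → A ⇒ Z → B ⇒ Z → A ⊕ B ⇒ Z
    []∘κ₁ : ∀ {A B Z} {f : A ⇒ Z} {g : B ⇒ Z} → [ f , g ] ∘ κ₁ ≈ f
    []∘κ₂ : ∀ {A B Z} {f : A ⇒ Z} {g : B ⇒ Z} → [ f , g ] ∘ κ₂ ≈ g
    []-unique : ∀ {A B Z} {f : A ⇒ Z} {g : B ⇒ Z} (h : A ⊕ B ⇒ Z) →
                h ∘ κ₁ ≈ f → h ∘ κ₂ ≈ g → h ≈ [ f , g ]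
    π₁∘κ₁ : ∀ {A B} → π₁ {A} {B} ∘ κ₁ ≈ id
    π₂∘κ₂ : ∀ {A B} → π₂ {A} {B} ∘ κ₂ ≈ id
    π₂∘κ₁ : ∀ {A B} → π₂ {A} {B} ∘ κ₁ ≈ 0m
    π₁∘κ₂ : ∀ {A B} → π₁ {A} {B} ∘ κ₂ ≈ 0m

  infixr 6 _⊕₁_
  infixl 7 _+_

  _⊕₁_ : ∀ {A B C D} → A ⇒ B → C ⇒ D → A ⊕ C ⇒ B ⊕ D
  h ⊕₁ k = [ κ₁ ∘ h , κ₂ ∘ k ]

  ∇ : ∀ {A} → A ⊕ A ⇒ A
  ∇ = [ id , id ]

  Δ : ∀ {A} → A ⇒ A ⊕ A
  Δ = ⟨ id , id ⟩

  _+_ : ∀ {A B} → A ⇒ B → A ⇒ B → A ⇒ B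
  f + g = ∇ ∘ (f ⊕₁ g) ∘ Δ

  ZeroMonic : ∀ {A B} → A ⇒ B → Set (o ⊔ ℓ ⊔ e)
  ZeroMonic {A} g = ∀ {Z} (h : Z ⇒ A) → g ∘ h ≈ 0m → h ≈ 0m

record AdditiveCategory (o ℓ e : Level) : Set (suc (o ⊔ ℓ ⊔ e)) where
  field
    biproductCategory : BiproductCategory o ℓ e
  open BiproductCategory biproductCategory public
  field
    -_ : ∀ {A B} → A ⇒ B → A ⇒ B
    homAbelianGroup : ∀ {A B} → IsAbelianGroup (_≈_ {A} {B}) _+_ 0m -_

record DaggerBiproductCategory (o ℓ e : Level) : Set (suc (o ⊔ ℓ ⊔ e)) where
  field
    biproductCategory : BiproductCategory o ℓ e
  open BiproductCategory biproductCategory public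
  field
    _† : ∀ {A B} → A ⇒ B → B ⇒ A
    †-resp-≈ : ∀ {A B} {f g : A ⇒ B} → f ≈ g → f † ≈ g †
    †-id : ∀ {A} → (id {A}) † ≈ id
    †-∘ : ∀ {A B C} {f : A ⇒ B} {g : B ⇒ C} → (g ∘ f) † ≈ f † ∘ g †
    †-involutive : ∀ {A B} {f : A ⇒ B} → (f †) † ≈ f
    π₁† : ∀ {A B} → (π₁ {A} {B}) † ≈ κ₁
    π₂† : ∀ {A B} → (π₂ {A} {B}) † ≈ κ₂

  Unitary : ∀ {A B} → A ⇒ B → Set e
  Unitary f = (f † ∘ f ≈ id) × (f ∘ f † ≈ id)

module Submission where

-- Everything is reduced to a handful of general facts.
--  * Category level: a commuting square whose top edge is an isomorphism
--    and whose bottom edge is split monic is a pullback (`iso-pullback`).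
--  * Biproducts: (-) ⊕₁ (-) is a functor, ∇ is natural, and + distributes
--    over precomposition and has the zero map as unit.  From these:
--    (E) is a pullback because the mediating map can be read off
--    componentwise; (K+) is a pullback because the second component of a
--    cone is killed by the zero-monic g; (K) is (K+) with g = id; and (D),
--    (D+) are pullbacks for every isomorphism f by naturality of ∇ and
--    `iso-pullback`.
--  * A cotuple [ h , κ₂ ] out of A ⊕ C into B ⊕ C is the tuple
--    ⟨ π₁ h π₁ , π₂ h π₁ + π₂ ⟩; instantiating h = id and h = swap gives the
--    formulas of (ii), and joint monicity then follows by cancellation in
--    the abelian group of morphisms.
--  * In a dagger biproduct category a unitary map is an isomorphism with
--    inverse f †, so (iii) is the isomorphism case of (D) and (D+).

open import Defs
open import Data.Product using (_×_; _,_; proj₁; proj₂)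
open import Relation.Binary.Bundles using (Setoid)
open import Relation.Binary.Structures using (IsEquivalence)
open import Algebra.Bundles using (AbelianGroup)
import Algebra.Properties.Group as GroupProperties
import Relation.Binary.Reasoning.Setoid as SetoidReasoning

module CategoryFacts {o ℓ e} (𝒞 : Category o ℓ e) where
  open Category 𝒞

  hom-setoid : Obj → Obj → Setoid ℓ e
  hom-setoid A B = record { Carrier = A ⇒ B ; _≈_ = _≈_ ; isEquivalence = ≈-equiv }

  module ≈ {A B : Obj} = IsEquivalence (≈-equiv {A} {B})
  module HomReasoning {A B : Obj} = SetoidReasoning (hom-setoid A B)

  ∘-resp-≈ʳ : ∀ {A B C} {f : B ⇒ C} {g h : A ⇒ B} → g ≈ h → f ∘ g ≈ f ∘ h
  ∘-resp-≈ʳ p = ∘-resp-≈ ≈.refl p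

  ∘-resp-≈ˡ : ∀ {A B C} {f : A ⇒ B} {g h : B ⇒ C} → g ≈ h → g ∘ f ≈ h ∘ f
  ∘-resp-≈ˡ p = ∘-resp-≈ p ≈.refl

  sym-assoc : ∀ {A B C D} {f : A ⇒ B} {g : B ⇒ C} {h : C ⇒ D} →
              h ∘ (g ∘ f) ≈ (h ∘ g) ∘ f
  sym-assoc = ≈.sym assoc

  cancelˡ : ∀ {A B C} {f : B ⇒ C} {g : C ⇒ B} {h : A ⇒ B} →
            g ∘ f ≈ id → g ∘ (f ∘ h) ≈ h
  cancelˡ p = ≈.trans sym-assoc (≈.trans (∘-resp-≈ˡ p) identityˡ)

  Inverse : ∀ {A B} → A ⇒ B → B ⇒ A → Set e
  Inverse f g = (g ∘ f ≈ id) × (f ∘ g ≈ id)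

  -- A commuting square whose top is an isomorphism and whose bottom has a
  -- retraction is a pullback: the mediating map is forced to be
  -- top⁻¹ ∘ h₁.  This is the engine behind (D) and (D+).
  iso-pullback : ∀ {P Q R S} {top : P ⇒ Q} {left : P ⇒ R} {right : Q ⇒ S} {bot : R ⇒ S}
    (top⁻¹ : Q ⇒ P) → Inverse top top⁻¹ → (r : S ⇒ R) → r ∘ bot ≈ id →
    right ∘ top ≈ bot ∘ left → IsPullbackSquare top left right bot
  iso-pullback {P} {Q} {R} {_} {top} {left} {right} {bot} top⁻¹ (inv-top , top-inv) r retract commutes =
    commutes , λ h₁ h₂ cone → top⁻¹ ∘ h₁ , top-mediates , left-mediates h₁ h₂ cone , unique
    where
    open HomReasoning
    top-mediates : ∀ {Z} {h₁ : Z ⇒ Q} → top ∘ (top⁻¹ ∘ h₁) ≈ h₁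
    top-mediates = cancelˡ top-inv
    left-mediates : ∀ {Z} (h₁ : Z ⇒ Q) (h₂ : Z ⇒ R) → right ∘ h₁ ≈ bot ∘ h₂ →
                    left ∘ (top⁻¹ ∘ h₁) ≈ h₂
    left-mediates h₁ h₂ cone = begin
      left ∘ (top⁻¹ ∘ h₁)              ≈⟨ cancelˡ retract ⟨
      r ∘ (bot ∘ (left ∘ (top⁻¹ ∘ h₁))) ≈⟨ ∘-resp-≈ʳ sym-assoc ⟩
      r ∘ ((bot ∘ left) ∘ (top⁻¹ ∘ h₁)) ≈⟨ ∘-resp-≈ʳ (∘-resp-≈ˡ commutes) ⟨
      r ∘ ((right ∘ top) ∘ (top⁻¹ ∘ h₁)) ≈⟨ ∘-resp-≈ʳ (≈.trans assoc (∘-resp-≈ʳ top-mediates)) ⟩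
      r ∘ (right ∘ h₁)                  ≈⟨ ∘-resp-≈ʳ cone ⟩
      r ∘ (bot ∘ h₂)                    ≈⟨ cancelˡ retract ⟩
      h₂                                ∎
    unique : ∀ {Z} {h₁ : Z ⇒ Q} {h₂ : Z ⇒ R} (v : Z ⇒ P) → top ∘ v ≈ h₁ → left ∘ v ≈ h₂ →
             v ≈ top⁻¹ ∘ h₁
    unique v top-v _ = ≈.trans (≈.sym (cancelˡ inv-top)) (∘-resp-≈ʳ top-v)

module BiproductFacts {o ℓ e} (𝒞 : BiproductCategory o ℓ e) where
  open BiproductCategory 𝒞
  open CategoryFacts category

  0m-absorbˡ : ∀ {A B C} {f : B ⇒ C} → f ∘ 0m {A} {B} ≈ 0m
  0m-absorbˡ {f = f} = ≈.trans sym-assoc (∘-resp-≈ˡ (¡-unique (f ∘ ¡)))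

  0m-absorbʳ : ∀ {A B C} {f : A ⇒ B} → 0m {B} {C} ∘ f ≈ 0m
  0m-absorbʳ {f = f} = ≈.trans assoc (∘-resp-≈ʳ (!-unique (! ∘ f)))

  ⟨⟩-ext : ∀ {Z A B} {a b : Z ⇒ A ⊕ B} → π₁ ∘ a ≈ π₁ ∘ b → π₂ ∘ a ≈ π₂ ∘ b → a ≈ b
  ⟨⟩-ext {a = a} {b} p q = ≈.trans (⟨⟩-unique a p q) (≈.sym (⟨⟩-unique b ≈.refl ≈.refl))

  []-ext : ∀ {Z A B} {a b : A ⊕ B ⇒ Z} → a ∘ κ₁ ≈ b ∘ κ₁ → a ∘ κ₂ ≈ b ∘ κ₂ → a ≈ b
  []-ext {a = a} {b} p q = ≈.trans ([]-unique a p q) (≈.sym ([]-unique b ≈.refl ≈.refl))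

  ⟨⟩∘ : ∀ {Y Z A B} {f : Z ⇒ A} {g : Z ⇒ B} {h : Y ⇒ Z} → ⟨ f , g ⟩ ∘ h ≈ ⟨ f ∘ h , g ∘ h ⟩
  ⟨⟩∘ = ⟨⟩-unique _ (≈.trans sym-assoc (∘-resp-≈ˡ π₁∘⟨⟩)) (≈.trans sym-assoc (∘-resp-≈ˡ π₂∘⟨⟩))

  ⟨⟩-cong : ∀ {Z A B} {f f' : Z ⇒ A} {g g' : Z ⇒ B} → f ≈ f' → g ≈ g' → ⟨ f , g ⟩ ≈ ⟨ f' , g' ⟩
  ⟨⟩-cong p q = ⟨⟩-unique _ (≈.trans π₁∘⟨⟩ p) (≈.trans π₂∘⟨⟩ q)

  ⟨⟩-equalizes : ∀ {Z P A B} {m : P ⇒ A ⊕ B} {f : P ⇒ A} {g : P ⇒ B} {u v : Z ⇒ P} →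
                 m ≈ ⟨ f , g ⟩ → m ∘ u ≈ m ∘ v → (f ∘ u ≈ f ∘ v) × (g ∘ u ≈ g ∘ v)
  ⟨⟩-equalizes {Z} {P} {A} {B} {m} {f} {g} m-tuple eq =
    ≈.trans (component π₁∘⟨⟩) (≈.trans (∘-resp-≈ʳ eq) (≈.sym (component π₁∘⟨⟩))) ,
    ≈.trans (component π₂∘⟨⟩) (≈.trans (∘-resp-≈ʳ eq) (≈.sym (component π₂∘⟨⟩)))
    where
    component : ∀ {W} {c : A ⊕ B ⇒ W} {t : P ⇒ W} {w : Z ⇒ P} →
                c ∘ ⟨ f , g ⟩ ≈ t → t ∘ w ≈ c ∘ (m ∘ w)
    component ct = ≈.trans (∘-resp-≈ˡ (≈.trans (≈.sym ct) (∘-resp-≈ʳ (≈.sym m-tuple)))) assoc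

  κ₁-as-tuple : ∀ {A B} → κ₁ {A} {B} ≈ ⟨ id , 0m ⟩
  κ₁-as-tuple = ⟨⟩-unique κ₁ π₁∘κ₁ π₂∘κ₁

  κ₂-as-tuple : ∀ {A B} → κ₂ {A} {B} ≈ ⟨ 0m , id ⟩
  κ₂-as-tuple = ⟨⟩-unique κ₂ π₁∘κ₂ π₂∘κ₂

  π₁κ₁∘ : ∀ {Z A B} {x : Z ⇒ A} → π₁ {A} {B} ∘ (κ₁ ∘ x) ≈ x
  π₁κ₁∘ = cancelˡ π₁∘κ₁

  π₂κ₁∘ : ∀ {Z A B} {x : Z ⇒ A} → π₂ {A} {B} ∘ (κ₁ ∘ x) ≈ 0m
  π₂κ₁∘ = ≈.trans sym-assoc (≈.trans (∘-resp-≈ˡ π₂∘κ₁) 0m-absorbʳ)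

  π₁κ₂∘ : ∀ {Z A B} {x : Z ⇒ B} → π₁ {A} {B} ∘ (κ₂ ∘ x) ≈ 0m
  π₁κ₂∘ = ≈.trans sym-assoc (≈.trans (∘-resp-≈ˡ π₁∘κ₂) 0m-absorbʳ)

  π₂κ₂∘ : ∀ {Z A B} {x : Z ⇒ B} → π₂ {A} {B} ∘ (κ₂ ∘ x) ≈ x
  π₂κ₂∘ = cancelˡ π₂∘κ₂

  π₁∘⊕ : ∀ {A B C D} {h : A ⇒ B} {k : C ⇒ D} → π₁ ∘ (h ⊕₁ k) ≈ h ∘ π₁
  π₁∘⊕ = []-ext
    (≈.trans assoc (≈.trans (∘-resp-≈ʳ []∘κ₁) (≈.trans π₁κ₁∘
      (≈.sym (≈.trans assoc (≈.trans (∘-resp-≈ʳ π₁∘κ₁) identityʳ))))))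
    (≈.trans assoc (≈.trans (∘-resp-≈ʳ []∘κ₂) (≈.trans π₁κ₂∘
      (≈.sym (≈.trans assoc (≈.trans (∘-resp-≈ʳ π₁∘κ₂) 0m-absorbˡ))))))

  π₂∘⊕ : ∀ {A B C D} {h : A ⇒ B} {k : C ⇒ D} → π₂ ∘ (h ⊕₁ k) ≈ k ∘ π₂
  π₂∘⊕ = []-ext
    (≈.trans assoc (≈.trans (∘-resp-≈ʳ []∘κ₁) (≈.trans π₂κ₁∘
      (≈.sym (≈.trans assoc (≈.trans (∘-resp-≈ʳ π₂∘κ₁) 0m-absorbˡ))))))
    (≈.trans assoc (≈.trans (∘-resp-≈ʳ []∘κ₂) (≈.trans π₂κ₂∘
      (≈.sym (≈.trans assoc (≈.trans (∘-resp-≈ʳ π₂∘κ₂) identityʳ))))))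

  π₁⊕∘ : ∀ {Z A B C D} {h : A ⇒ B} {k : C ⇒ D} {x : Z ⇒ A ⊕ C} →
         π₁ ∘ ((h ⊕₁ k) ∘ x) ≈ h ∘ (π₁ ∘ x)
  π₁⊕∘ = ≈.trans sym-assoc (≈.trans (∘-resp-≈ˡ π₁∘⊕) assoc)

  π₂⊕∘ : ∀ {Z A B C D} {h : A ⇒ B} {k : C ⇒ D} {x : Z ⇒ A ⊕ C} →
         π₂ ∘ ((h ⊕₁ k) ∘ x) ≈ k ∘ (π₂ ∘ x)
  π₂⊕∘ = ≈.trans sym-assoc (≈.trans (∘-resp-≈ˡ π₂∘⊕) assoc)

  ⊕-cong : ∀ {A B C D} {h h' : A ⇒ B} {k k' : C ⇒ D} → h ≈ h' → k ≈ k' → h ⊕₁ k ≈ h' ⊕₁ k'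
  ⊕-cong p q = ⟨⟩-ext (≈.trans π₁∘⊕ (≈.trans (∘-resp-≈ˡ p) (≈.sym π₁∘⊕)))
                      (≈.trans π₂∘⊕ (≈.trans (∘-resp-≈ˡ q) (≈.sym π₂∘⊕)))

  ⊕∘⊕ : ∀ {A B C D E F} {a : B ⇒ C} {b : E ⇒ F} {c : A ⇒ B} {d : D ⇒ E} →
        (a ⊕₁ b) ∘ (c ⊕₁ d) ≈ (a ∘ c) ⊕₁ (b ∘ d)
  ⊕∘⊕ = ⟨⟩-ext (≈.trans π₁⊕∘ (≈.trans (∘-resp-≈ʳ π₁∘⊕) (≈.trans sym-assoc (≈.sym π₁∘⊕))))
               (≈.trans π₂⊕∘ (≈.trans (∘-resp-≈ʳ π₂∘⊕) (≈.trans sym-assoc (≈.sym π₂∘⊕))))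

  ⊕-id : ∀ {A B} → id {A} ⊕₁ id {B} ≈ id
  ⊕-id = ⟨⟩-ext (≈.trans π₁∘⊕ (≈.trans identityˡ (≈.sym identityʳ)))
                (≈.trans π₂∘⊕ (≈.trans identityˡ (≈.sym identityʳ)))

  ⊕-square : ∀ {A B C E} {h₁ : B ⇒ C} {k₁ : A ⇒ B} {k₁' : E ⇒ C} {h₁' : A ⇒ E}
               {A' B' C' E'} {h₂ : B' ⇒ C'} {k₂ : A' ⇒ B'} {k₂' : E' ⇒ C'} {h₂' : A' ⇒ E'} →
             h₁ ∘ k₁ ≈ k₁' ∘ h₁' → h₂ ∘ k₂ ≈ k₂' ∘ h₂' →
             (h₁ ⊕₁ h₂) ∘ (k₁ ⊕₁ k₂) ≈ (k₁' ⊕₁ k₂') ∘ (h₁' ⊕₁ h₂')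
  ⊕-square p q = ≈.trans ⊕∘⊕ (≈.trans (⊕-cong p q) (≈.sym ⊕∘⊕))

  ⊕-inverse : ∀ {A B C D} {a : A ⇒ B} {a⁻¹ : B ⇒ A} {b : C ⇒ D} {b⁻¹ : D ⇒ C} →
              Inverse a a⁻¹ → Inverse b b⁻¹ → Inverse (a ⊕₁ b) (a⁻¹ ⊕₁ b⁻¹)
  ⊕-inverse (pa , qa) (pb , qb) =
    ≈.trans ⊕∘⊕ (≈.trans (⊕-cong pa pb) ⊕-id) , ≈.trans ⊕∘⊕ (≈.trans (⊕-cong qa qb) ⊕-id)

  ∇-natural : ∀ {A B} {h : A ⇒ B} → ∇ ∘ (h ⊕₁ h) ≈ h ∘ ∇
  ∇-natural {A} {B} {h} = []-ext (on-summand []∘κ₁ []∘κ₁ []∘κ₁) (on-summand []∘κ₂ []∘κ₂ []∘κ₂)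
    where
    on-summand : ∀ {s : A ⇒ A ⊕ A} {s' : B ⇒ B ⊕ B} →
                 (h ⊕₁ h) ∘ s ≈ s' ∘ h → ∇ ∘ s' ≈ id → ∇ ∘ s ≈ id →
                 (∇ ∘ (h ⊕₁ h)) ∘ s ≈ (h ∘ ∇) ∘ s
    on-summand natural ∇s' ∇s =
      ≈.trans assoc (≈.trans (∘-resp-≈ʳ natural) (≈.trans (cancelˡ ∇s')
        (≈.sym (≈.trans assoc (≈.trans (∘-resp-≈ʳ ∇s) identityʳ)))))

  ⊕∘Δ : ∀ {A B C} {f : A ⇒ B} {g : A ⇒ C} → (f ⊕₁ g) ∘ Δ ≈ ⟨ f , g ⟩
  ⊕∘Δ = ⟨⟩-unique _ (≈.trans π₁⊕∘ (≈.trans (∘-resp-≈ʳ π₁∘⟨⟩) identityʳ))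
                    (≈.trans π₂⊕∘ (≈.trans (∘-resp-≈ʳ π₂∘⟨⟩) identityʳ))

  +-as-tuple : ∀ {A B} {f g : A ⇒ B} → f + g ≈ ∇ ∘ ⟨ f , g ⟩
  +-as-tuple = ∘-resp-≈ʳ ⊕∘Δ

  +-cong : ∀ {A B} {f f' g g' : A ⇒ B} → f ≈ f' → g ≈ g' → f + g ≈ f' + g'
  +-cong p q = ∘-resp-≈ʳ (∘-resp-≈ˡ (⊕-cong p q))

  +-identityʳ : ∀ {A B} {f : A ⇒ B} → f + 0m ≈ f
  +-identityʳ = ≈.trans +-as-tuple
    (≈.trans (∘-resp-≈ʳ (≈.trans (⟨⟩-cong (≈.sym identityˡ) (≈.sym 0m-absorbʳ))
                                 (≈.trans (≈.sym ⟨⟩∘) (∘-resp-≈ˡ (≈.sym κ₁-as-tuple)))))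
             (≈.trans sym-assoc (≈.trans (∘-resp-≈ˡ []∘κ₁) identityˡ)))

  +-identityˡ : ∀ {A B} {f : A ⇒ B} → 0m + f ≈ f
  +-identityˡ = ≈.trans +-as-tuple
    (≈.trans (∘-resp-≈ʳ (≈.trans (⟨⟩-cong (≈.sym 0m-absorbʳ) (≈.sym identityˡ))
                                 (≈.trans (≈.sym ⟨⟩∘) (∘-resp-≈ˡ (≈.sym κ₂-as-tuple)))))
             (≈.trans sym-assoc (≈.trans (∘-resp-≈ˡ []∘κ₂) identityˡ)))

  +-∘ : ∀ {A B C} {f g : B ⇒ C} {h : A ⇒ B} → (f + g) ∘ h ≈ (f ∘ h) + (g ∘ h)
  +-∘ {f = f} {g} {h} = ≈.trans assoc (∘-resp-≈ʳ (begin
    ((f ⊕₁ g) ∘ Δ) ∘ h  ≈⟨ ∘-resp-≈ˡ ⊕∘Δ ⟩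
    ⟨ f , g ⟩ ∘ h       ≈⟨ ⟨⟩∘ ⟩
    ⟨ f ∘ h , g ∘ h ⟩   ≈⟨ ⊕∘Δ ⟨
    ((f ∘ h) ⊕₁ (g ∘ h)) ∘ Δ ∎))
    where open HomReasoning

  [-,κ₂]-as-tuple : ∀ {A B C} {h : A ⇒ B ⊕ C} →
                    [ h , κ₂ ] ≈ ⟨ π₁ ∘ h ∘ π₁ , (π₂ ∘ h ∘ π₁) + π₂ ⟩
  [-,κ₂]-as-tuple {A} {B} {C} {h} = ≈.sym ([]-unique _
    (≈.trans ⟨⟩∘ (≈.trans (⟨⟩-cong after-κ₁ (≈.trans +-∘ (≈.trans (+-cong after-κ₁ π₂∘κ₁) +-identityʳ)))
                          (≈.sym (⟨⟩-unique h ≈.refl ≈.refl))))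
    (≈.trans ⟨⟩∘ (≈.trans (⟨⟩-cong after-κ₂ (≈.trans +-∘ (≈.trans (+-cong after-κ₂ π₂∘κ₂) +-identityˡ)))
                          (≈.sym κ₂-as-tuple))))
    where
    after-κ₁ : ∀ {W} {p : B ⊕ C ⇒ W} → (p ∘ h ∘ π₁) ∘ κ₁ ≈ p ∘ h
    after-κ₁ = ≈.trans assoc (∘-resp-≈ʳ (≈.trans assoc (≈.trans (∘-resp-≈ʳ π₁∘κ₁) identityʳ)))
    after-κ₂ : ∀ {W} {p : B ⊕ C ⇒ W} → (p ∘ h ∘ π₁) ∘ κ₂ ≈ 0m
    after-κ₂ = ≈.trans assoc (≈.trans (∘-resp-≈ʳ (≈.trans assoc (≈.trans (∘-resp-≈ʳ π₁∘κ₂) 0m-absorbˡ)))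
                                      0m-absorbˡ)

  first-formula : ∀ X → [ id , κ₂ ] ≈ ⟨ π₁ ∘ π₁ , (π₂ ∘ π₁) + π₂ ⟩
  first-formula X = ≈.trans ([-,κ₂]-as-tuple {A = X ⊕ X} {h = id})
    (⟨⟩-cong (∘-resp-≈ʳ identityˡ) (+-cong (∘-resp-≈ʳ identityˡ) ≈.refl))

  π₁∘swap : ∀ {X} → π₁ ∘ [ κ₂ , κ₁ ] ≈ π₂ {X} {X}
  π₁∘swap = []-ext (≈.trans assoc (≈.trans (∘-resp-≈ʳ []∘κ₁) (≈.trans π₁∘κ₂ (≈.sym π₂∘κ₁))))
                   (≈.trans assoc (≈.trans (∘-resp-≈ʳ []∘κ₂) (≈.trans π₁∘κ₁ (≈.sym π₂∘κ₂))))

  π₂∘swap : ∀ {X} → π₂ ∘ [ κ₂ , κ₁ ] ≈ π₁ {X} {X}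
  π₂∘swap = []-ext (≈.trans assoc (≈.trans (∘-resp-≈ʳ []∘κ₁) (≈.trans π₂∘κ₂ (≈.sym π₁∘κ₁))))
                   (≈.trans assoc (≈.trans (∘-resp-≈ʳ []∘κ₂) (≈.trans π₂∘κ₁ (≈.sym π₁∘κ₂))))

  second-formula : ∀ X → [ [ κ₂ , κ₁ ] , κ₂ ] ≈ ⟨ π₂ ∘ π₁ , (π₁ ∘ π₁) + π₂ ⟩
  second-formula X = ≈.trans ([-,κ₂]-as-tuple {A = X ⊕ X} {h = [ κ₂ , κ₁ ]})
    (⟨⟩-cong (≈.trans sym-assoc (∘-resp-≈ˡ π₁∘swap))
             (+-cong (≈.trans sym-assoc (∘-resp-≈ˡ π₂∘swap)) ≈.refl))

  E-pullback : ∀ {A B X Y} (f : A ⇒ B) (g : X ⇒ Y) →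
               IsPullbackSquare (id ⊕₁ g) (f ⊕₁ id) (f ⊕₁ id) (id ⊕₁ g)
  E-pullback {A} {B} {X} {Y} f g = commutes , λ h₁ h₂ cone →
    ⟨ π₁ ∘ h₁ , π₂ ∘ h₂ ⟩ ,
    ⟨⟩-ext (≈.trans π₁⊕∘ (≈.trans identityˡ π₁∘⟨⟩))
           (≈.trans π₂⊕∘ (≈.trans (∘-resp-≈ʳ π₂∘⟨⟩) (second-agrees cone))) ,
    ⟨⟩-ext (≈.trans π₁⊕∘ (≈.trans (∘-resp-≈ʳ π₁∘⟨⟩) (first-agrees cone)))
           (≈.trans π₂⊕∘ (≈.trans identityˡ π₂∘⟨⟩)) ,
    λ v top-v left-v →
      ⟨⟩-ext (≈.trans (≈.sym identityˡ) (≈.trans (≈.sym π₁⊕∘) (≈.trans (∘-resp-≈ʳ top-v) (≈.sym π₁∘⟨⟩))))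
             (≈.trans (≈.sym identityˡ) (≈.trans (≈.sym π₂⊕∘) (≈.trans (∘-resp-≈ʳ left-v) (≈.sym π₂∘⟨⟩))))
    where
    commutes : (f ⊕₁ id) ∘ (id ⊕₁ g) ≈ (id ⊕₁ g) ∘ (f ⊕₁ id)
    commutes = ⊕-square (≈.trans identityʳ (≈.sym identityˡ)) (≈.trans identityˡ (≈.sym identityʳ))
    first-agrees : ∀ {Z} {h₁ : Z ⇒ A ⊕ Y} {h₂ : Z ⇒ B ⊕ X} →
                   (f ⊕₁ id) ∘ h₁ ≈ (id ⊕₁ g) ∘ h₂ → f ∘ (π₁ ∘ h₁) ≈ π₁ ∘ h₂
    first-agrees cone = ≈.trans (≈.sym π₁⊕∘) (≈.trans (∘-resp-≈ʳ cone) (≈.trans π₁⊕∘ identityˡ))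
    second-agrees : ∀ {Z} {h₁ : Z ⇒ A ⊕ Y} {h₂ : Z ⇒ B ⊕ X} →
                    (f ⊕₁ id) ∘ h₁ ≈ (id ⊕₁ g) ∘ h₂ → g ∘ (π₂ ∘ h₂) ≈ π₂ ∘ h₁
    second-agrees cone = ≈.trans (≈.sym π₂⊕∘) (≈.trans (∘-resp-≈ʳ (≈.sym cone)) (≈.trans π₂⊕∘ identityˡ))

  -- (K+) is a pullback when g is zero monic: the second component of a
  -- cone h₂ satisfies g ∘ π₂ h₂ ≈ 0, hence vanishes, so h₂ ≈ κ₁ ∘ π₁ h₂.
  K+-pullback : ∀ {X Y A B} (f : X ⇒ Y) (g : A ⇒ B) → ZeroMonic g →
                IsPullbackSquare f (κ₁ {X} {A}) (κ₁ {Y} {B}) (f ⊕₁ g)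
  K+-pullback f g g-zeroMonic = ≈.sym []∘κ₁ , λ h₁ h₂ cone →
    π₁ ∘ h₂ ,
    (begin
      f ∘ (π₁ ∘ h₂)         ≈⟨ π₁⊕∘ ⟨
      π₁ ∘ ((f ⊕₁ g) ∘ h₂)  ≈⟨ ∘-resp-≈ʳ cone ⟨
      π₁ ∘ (κ₁ ∘ h₁)        ≈⟨ π₁κ₁∘ ⟩
      h₁                    ∎) ,
    ⟨⟩-ext π₁κ₁∘ (≈.trans π₂κ₁∘ (≈.sym (g-zeroMonic (π₂ ∘ h₂) (begin
      g ∘ (π₂ ∘ h₂)         ≈⟨ π₂⊕∘ ⟨
      π₂ ∘ ((f ⊕₁ g) ∘ h₂)  ≈⟨ ∘-resp-≈ʳ cone ⟨
      π₂ ∘ (κ₁ ∘ h₁)        ≈⟨ π₂κ₁∘ ⟩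
      0m                    ∎)))) ,
    λ v _ left-v → ≈.trans (≈.sym π₁κ₁∘) (∘-resp-≈ʳ left-v)
    where open HomReasoning

  id-zeroMonic : ∀ {A} → ZeroMonic (id {A})
  id-zeroMonic _ p = ≈.trans (≈.sym identityˡ) p

  K-pullback : ∀ {X Y A} (f : X ⇒ Y) → IsPullbackSquare f (κ₁ {X} {A}) (κ₁ {Y} {A}) (f ⊕₁ id)
  K-pullback f = K+-pullback f id id-zeroMonic

  -- (D) and (D+) are pullbacks for every isomorphism f: their tops and
  -- bottoms are sums of copies of f, hence isomorphisms.
  D-pullback : ∀ {X Y} {f : X ⇒ Y} {f⁻¹ : Y ⇒ X} → Inverse f f⁻¹ →
               IsPullbackSquare (f ⊕₁ f) ∇ ∇ f
  D-pullback {f⁻¹ = f⁻¹} inv =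
    iso-pullback (f⁻¹ ⊕₁ f⁻¹) (⊕-inverse inv inv) f⁻¹ (proj₁ inv) ∇-natural

  D+-pullback : ∀ {X Y} {f : X ⇒ Y} {f⁻¹ : Y ⇒ X} → Inverse f f⁻¹ →
                IsPullbackSquare ((f ⊕₁ f) ⊕₁ f) (∇ ⊕₁ id) (∇ ⊕₁ id) (f ⊕₁ f)
  D+-pullback {f⁻¹ = f⁻¹} inv =
    iso-pullback ((f⁻¹ ⊕₁ f⁻¹) ⊕₁ f⁻¹) (⊕-inverse (⊕-inverse inv inv) inv)
                 (f⁻¹ ⊕₁ f⁻¹) (proj₁ (⊕-inverse inv inv))
                 (⊕-square ∇-natural (≈.trans identityˡ (≈.sym identityʳ)))

module AdditiveFacts {o ℓ e} (𝒜 : AdditiveCategory o ℓ e) where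
  open AdditiveCategory 𝒜
  open CategoryFacts category
  open BiproductFacts biproductCategory

  hom-group : ∀ {A B} → AbelianGroup ℓ e
  hom-group {A} {B} = record { isAbelianGroup = homAbelianGroup {A} {B} }

  +-cancelˡ : ∀ {A B} {f g h : A ⇒ B} → f + g ≈ f + h → g ≈ h
  +-cancelˡ {A} {B} {f} {g} {h} =
    GroupProperties.∙-cancelˡ (AbelianGroup.group (hom-group {A} {B})) f g h

  -- Writing u : Z ⇒ (X ⊕ X) ⊕ X as components (x₁, x₂, x₃), the first map
  -- determines x₁ and x₂ + x₃, the second x₂ and x₁ + x₃; cancelling x₂
  -- recovers x₃.
  jointly-monic : ∀ X → JointlyMonic {(X ⊕ X) ⊕ X} {X ⊕ X} [ id , κ₂ ] [ [ κ₂ , κ₁ ] , κ₂ ]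
  jointly-monic X u v eq₁ eq₂ =
    ⟨⟩-ext (⟨⟩-ext (reassoc x₁-eq) (reassoc x₂-eq)) x₃-eq
    where
    first-components : ((π₁ ∘ π₁) ∘ u ≈ (π₁ ∘ π₁) ∘ v)
                     × (((π₂ ∘ π₁) + π₂) ∘ u ≈ ((π₂ ∘ π₁) + π₂) ∘ v)
    first-components = ⟨⟩-equalizes (first-formula X) eq₁
    second-components : ((π₂ ∘ π₁) ∘ u ≈ (π₂ ∘ π₁) ∘ v)
                      × (((π₁ ∘ π₁) + π₂) ∘ u ≈ ((π₁ ∘ π₁) + π₂) ∘ v)
    second-components = ⟨⟩-equalizes (second-formula X) eq₂
    x₁-eq : (π₁ ∘ π₁) ∘ u ≈ (π₁ ∘ π₁) ∘ v
    x₁-eq = proj₁ first-components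
    x₂-eq : (π₂ ∘ π₁) ∘ u ≈ (π₂ ∘ π₁) ∘ v
    x₂-eq = proj₁ second-components
    x₃-eq : π₂ ∘ u ≈ π₂ ∘ v
    x₃-eq = +-cancelˡ (≈.trans (≈.sym +-∘) (≈.trans (proj₂ first-components)
                       (≈.trans +-∘ (+-cong (≈.sym x₂-eq) ≈.refl))))
    reassoc : ∀ {p : X ⊕ X ⇒ X} → (p ∘ π₁) ∘ u ≈ (p ∘ π₁) ∘ v → p ∘ (π₁ ∘ u) ≈ p ∘ (π₁ ∘ v)
    reassoc eq = ≈.trans sym-assoc (≈.trans eq assoc)

lemma2p3 : ∀ {o ℓ e} →
  -- (i) biproduct categories: (E), (K), (K+) are pullbacks
  (∀ (𝒞 : BiproductCategory o ℓ e) → let open BiproductCategory 𝒞 in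
    (∀ {A B X Y} (f : A ⇒ B) (g : X ⇒ Y) →
       IsPullbackSquare (id ⊕₁ g) (f ⊕₁ id) (f ⊕₁ id) (id ⊕₁ g))
    × (∀ {X Y A} (f : X ⇒ Y) →
       IsPullbackSquare f (κ₁ {X} {A}) (κ₁ {Y} {A}) (f ⊕₁ id))
    × (∀ {X Y A B} (f : X ⇒ Y) (g : A ⇒ B) → ZeroMonic g →
       IsPullbackSquare f (κ₁ {X} {A}) (κ₁ {Y} {B}) (f ⊕₁ g)))
  -- (ii) additive categories: the two maps are jointly monic
  × (∀ (𝒜 : AdditiveCategory o ℓ e) → let open AdditiveCategory 𝒜 in
    ∀ X →
      (_≈_ {(X ⊕ X) ⊕ X} {X ⊕ X} [ id , κ₂ ] ⟨ π₁ ∘ π₁ , (π₂ ∘ π₁) + π₂ ⟩)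
      × (_≈_ {(X ⊕ X) ⊕ X} {X ⊕ X} [ [ κ₂ , κ₁ ] , κ₂ ] ⟨ π₂ ∘ π₁ , (π₁ ∘ π₁) + π₂ ⟩)
      × JointlyMonic {(X ⊕ X) ⊕ X} {X ⊕ X} [ id , κ₂ ] [ [ κ₂ , κ₁ ] , κ₂ ])
  -- (iii) dagger biproduct categories: (D), (D+) are pullbacks for unitary f
  × (∀ (𝒟 : DaggerBiproductCategory o ℓ e) → let open DaggerBiproductCategory 𝒟 in
    ∀ {X Y} (f : X ⇒ Y) → Unitary f →
      IsPullbackSquare (f ⊕₁ f) ∇ ∇ f
      × IsPullbackSquare ((f ⊕₁ f) ⊕₁ f) (∇ ⊕₁ id) (∇ ⊕₁ id) (f ⊕₁ f))
lemma2p3 =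
  (λ 𝒞 → let open BiproductFacts 𝒞 in E-pullback , K-pullback , K+-pullback) ,
  (λ 𝒜 → let open AdditiveCategory 𝒜 using (biproductCategory)
             open BiproductFacts biproductCategory
             open AdditiveFacts 𝒜 in
    λ X → first-formula X , second-formula X , jointly-monic X) ,
  -- A unitary f is an isomorphism with inverse f †.
  (λ 𝒟 → let open DaggerBiproductCategory 𝒟 using (biproductCategory)
             open BiproductFacts biproductCategory in
    λ f unitary → D-pullback unitary , D+-pullback unitary)
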